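{- Let $N\ge1$, $f:\mathbb{N}^N\to\mathbb{N}$, $p$ a prime, $k\ge0$ and $\boldsymbol{\ell}\in\mathbb{N}^N$. Write $k=k_0+k_1p$ with integers $0\le k_0<p$, $k_1\ge0$, and $\boldsymbol{\ell}=\boldsymbol{\ell}_0+p\mathbf{x}$ with $\mathbf{x}\in\mathbb{N}^N$ and every component of $\boldsymbol{\ell}_0$ in $\{0,\dots,p-1\}$. Then $$\binom{k}{\boldsymbol{\ell}}_f\equiv\sum_{\mathbf{m}\in\mathbb{N}^N}\binom{k_1}{\mathbf{x}-\mathbf{m}}_f\binom{k_0}{\boldsymbol{\ell}_0+p\mathbf{m}}_f\pmod p.$$
   Context: $\mathbb{N}=\{0,1,2,\dots\}$. For $k\ge0$ and $\boldsymbol{\ell}\in\mathbb{N}^N$, $\binom{k}{\boldsymbol{\ell}}_f=\sum f(\mathbf{m}_1)\cdots f(\mathbf{m}_k)$ over all ordered $k$-tuples of vectors $\mathbf{m}_j\in\mathbb{N}^N$ with $\mathbf{m}_1+\cdots+\mathbf{m}_k=\boldsymbol{\ell}$ (for $k=0$: $1$ if $\boldsymbol{\ell}=\mathbf{0}$, else $0$); $\binom{k}{\mathbf{y}}_f=0$ if $\mathbf{y}\in\mathbb{Z}^N$ has a negative entry (so the sum is finite). -}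

module Defs where

open import Data.Nat using (ℕ; zero; suc; _+_; _*_; _≤_; _<_)
open import Data.Nat.Properties using (_≟_)
open import Data.Integer using (ℤ; +_; -[1+_])
import Data.Integer
open import Data.List using (List; []; _∷_; map; concatMap; upTo; filterᵇ)
open import Data.Nat.ListAction using (sum; product)
open import Data.Vec using (Vec; []; _∷_; zipWith; replicate; foldr)
open import Data.Bool using (Bool; true; false; _∧_)
open import Relation.Nullary.Decidable using (⌊_⌋)

box : ∀ {N} → Vec ℕ N → List (Vec ℕ N)
box [] = [] ∷ []
box (a ∷ ℓ) = concatMap (λ i → map (i ∷_) (box ℓ)) (upTo (suc a))

tuples : ∀ {N} → ℕ → Vec ℕ N → List (List (Vec ℕ N))
tuples zero ℓ = [] ∷ []
tuples (suc k) ℓ = concatMap (λ m → map (m ∷_) (tuples k ℓ)) (box ℓ)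

vsum : ∀ {N} → List (Vec ℕ N) → Vec ℕ N
vsum {N} [] = replicate N 0
vsum (m ∷ ms) = zipWith _+_ m (vsum ms)

vecEqᵇ : ∀ {N} → Vec ℕ N → Vec ℕ N → Bool
vecEqᵇ [] [] = true
vecEqᵇ (a ∷ u) (b ∷ v) = ⌊ a ≟ b ⌋ ∧ vecEqᵇ u v

-- Generalized binomial (k choose ℓ)_f : sum of f(m_1)⋯f(m_k) over all ordered
-- k-tuples of vectors in ℕ^N summing to ℓ.  Every such m_j satisfies m_j ≤ ℓ,
-- so enumerating tuples from box ℓ is exhaustive.  For k = 0 this is 1 if ℓ = 0
-- and 0 otherwise (the empty tuple sums to 0).
binom : ∀ {N} → (Vec ℕ N → ℕ) → ℕ → Vec ℕ N → ℕ
binom f k ℓ = sum (map (λ ms → product (map f ms))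
                       (filterᵇ (λ ms → vecEqᵇ (vsum ms) ℓ) (tuples k ℓ)))

-- Extension to ℤ^N: zero if some entry is negative.
open import Data.Maybe using (Maybe; just; nothing)

toNatVec : ∀ {N} → Vec ℤ N → Maybe (Vec ℕ N)
toNatVec [] = just []
toNatVec (+ a ∷ y) with toNatVec y
... | just v = just (a ∷ v)
... | nothing = nothing
toNatVec (-[1+ _ ] ∷ y) = nothing

binomℤ : ∀ {N} → (Vec ℕ N → ℕ) → ℕ → Vec ℤ N → ℕ
binomℤ f k y with toNatVec y
... | just v = binom f k v
... | nothing = 0

vsubℤ : ∀ {N} → Vec ℕ N → Vec ℕ N → Vec ℤ N
vsubℤ = zipWith (λ a b → (+ a) Data.Integer.- (+ b))

-- binom f k ℓ is the coefficient of t^ℓ in F^k, where F = Σ_m f(m) t^m. Work with power series in N variables,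
-- truncated to the box [0, ℓ] and with coefficients mod p. There F^p ≡ F(t^p), because (x + y)^p ≡ x^p + y^p in
-- characteristic p and (t^d)^p = t^(pd). Hence F^k = F^k₀ (F^p)^k₁ ≡ F^k₀ F^k₁(t^p). Since every entry of ℓ₀ is
-- below p, the only ways to write ℓ₀ + p x as a + p j are a = ℓ₀ + p m, j = x − m with m ≤ x, and reading off the
-- coefficient of t^ℓ gives the stated sum.

module Submission where

open import Algebra.Bundles using (CommutativeSemiring)
open import Data.Empty using (⊥-elim)
open import Data.Fin.Base as Fin using (inject₁; fromℕ)
open import Data.Fin.Properties using (toℕ-fromℕ; toℕ-inject₁; toℕ<n)
open import Data.Nat.Base as ℕ using (ℕ; zero; suc; z<s; s<s; NonZero; _!)
open import Data.Nat.Combinatorics using (_C_; nCk≡n!/k![n-k]!; k![n∸k]!∣n!; nCn≡1)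
open import Data.Nat.DivMod using (m/n*n≡m)
open import Data.Nat.Primality using (Prime; euclidsLemma; prime⇒nonZero; ¬prime[0]; ¬prime[1])
import Data.Nat.Properties as ℕ
open import Data.Sum.Base using (inj₁; inj₂)
import Data.Vec.Functional as Vecᶠ
open import Relation.Binary.PropositionalEquality using (_≡_; refl; sym; trans; cong; cong₂; subst; module ≡-Reasoning)
open import Relation.Nullary using (Dec; does; yes; no; ¬_)

module _ where

  open import Data.Nat.Base using (_*_; _∸_; _<_; _≤_)
  open import Data.Nat.Divisibility using (_∣_; ∣1⇒≡1; ∣⇒≤; m∣m*n)
  open import Data.Nat.Properties using (<⇒≱; <-trans; n<1+n; <⇒≤; ∸-monoʳ-<; _!*_!≢0)

  n∣n! : ∀ n → .{{NonZero n}} → n ∣ n !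
  n∣n! (suc n) = m∣m*n (n !)

  C*k!*[n∸k]!≡n! : ∀ {n k} → k ≤ n → (n C k) * (k ! * (n ∸ k) !) ≡ n !
  C*k!*[n∸k]!≡n! {n} {k} k≤n =
    trans (cong (_* (k ! * (n ∸ k) !)) (nCk≡n!/k![n-k]! k≤n)) (m/n*n≡m (k![n∸k]!∣n! k≤n))
    where
    instance
      k!*[n∸k]!≢0 : NonZero (k ! * (n ∸ k) !)
      k!*[n∸k]!≢0 = k !* (n ∸ k) !≢0

  module _ {p : ℕ} (p-prime : Prime p) where

    private instance
      p≢0 : NonZero p
      p≢0 = prime⇒nonZero p-prime

    prime∤! : ∀ {k} → k < p → ¬ p ∣ k !
    prime∤! {zero} _ p∣1 = ¬prime[1] (subst Prime (∣1⇒≡1 p∣1) p-prime)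
    prime∤! {suc k} k<p p∣k! with euclidsLemma (suc k) (k !) p-prime p∣k!
    ... | inj₁ p∣1+k = <⇒≱ k<p (∣⇒≤ p∣1+k)
    ... | inj₂ p∣k! = prime∤! (<-trans (n<1+n k) k<p) p∣k!

    prime∣C : ∀ {k} → 0 < k → k < p → p ∣ p C k
    prime∣C {k} 0<k k<p
      with euclidsLemma (p C k) (k ! * (p ∸ k) !) p-prime
                        (subst (p ∣_) (sym (C*k!*[n∸k]!≡n! (<⇒≤ k<p))) (n∣n! p))
    ... | inj₁ p∣C = p∣C
    ... | inj₂ p∣k!*[p∸k]! with euclidsLemma (k !) ((p ∸ k) !) p-prime p∣k!*[p∸k]!
    ...   | inj₁ p∣k! = ⊥-elim (prime∤! k<p p∣k!)
    ...   | inj₂ p∣[p∸k]! = ⊥-elim (prime∤! (∸-monoʳ-< 0<k (<⇒≤ k<p)) p∣[p∸k]!)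

module FreshmansDream {c ℓ} (R : CommutativeSemiring c ℓ) where

  open import Data.Nat.Divisibility using (_∣_; divides)
  open CommutativeSemiring R renaming (refl to ≈-refl; sym to ≈-sym; trans to ≈-trans)
  open import Algebra.Properties.Semiring.Exp semiring using (_^_; ^-congʳ)
  open import Algebra.Properties.Semiring.Mult semiring using (_×_; ×-congˡ; ×-assocˡ)
  open import Algebra.Properties.CommutativeSemiring.Binomial R using (theorem; binomialTerm)
  open import Algebra.Properties.Monoid.Sum +-monoid using (sum; sum-init-last; sum-cong-≋; sum-replicate-zero)
  open import Relation.Binary.Reasoning.Setoid setoid

  freshman's-dream : ∀ {p} → Prime p → (∀ x → p × x ≈ 0#) → ∀ x y → (x + y) ^ p ≈ x ^ p + y ^ p
  freshman's-dream {zero} p-prime = ⊥-elim (¬prime[0] p-prime)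
  freshman's-dream {suc zero} p-prime = ⊥-elim (¬prime[1] p-prime)
  freshman's-dream {p@(suc (suc r))} p-prime p×≈0 x y = begin
    (x + y) ^ p                                               ≈⟨ theorem p x y ⟩
    t Fin.zero + sum (Vecᶠ.tail t)                            ≈⟨ +-congˡ (sum-init-last (Vecᶠ.tail t)) ⟩
    t Fin.zero + (sum (Vecᶠ.init (Vecᶠ.tail t)) + t (fromℕ p)) ≈⟨ +-cong first-term (+-cong middle-terms last-term) ⟩
    y ^ p + (0# + x ^ p)                                      ≈⟨ +-congˡ (+-identityˡ (x ^ p)) ⟩
    y ^ p + x ^ p                                             ≈⟨ +-comm (y ^ p) (x ^ p) ⟩
    x ^ p + y ^ p                                             ∎
    where
    t : Vecᶠ.Vector Carrier (suc p)
    t = binomialTerm x y p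
    first-term : t Fin.zero ≈ y ^ p
    first-term = ≈-trans (+-identityʳ _) (*-identityˡ (y ^ p))
    last-term : t (fromℕ p) ≈ x ^ p
    last-term = begin
      t (fromℕ p)                  ≡⟨ cong (λ k → (p C k) × (x ^ k * y ^ (p ℕ.∸ k))) (toℕ-fromℕ p) ⟩
      (p C p) × (x ^ p * y ^ (p ℕ.∸ p)) ≈⟨ ×-congˡ (nCn≡1 p) ⟩
      1 × (x ^ p * y ^ (p ℕ.∸ p))       ≈⟨ +-identityʳ _ ⟩
      x ^ p * y ^ (p ℕ.∸ p)             ≈⟨ *-congˡ (^-congʳ y (ℕ.n∸n≡0 p)) ⟩
      x ^ p * 1#                        ≈⟨ *-identityʳ (x ^ p) ⟩
      x ^ p                             ∎
    divisible-term : ∀ {n} → p ∣ n → ∀ z → n × z ≈ 0#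
    divisible-term (divides d refl) z = begin
      (d ℕ.* p) × z ≈⟨ ×-congˡ (ℕ.*-comm d p) ⟩
      (p ℕ.* d) × z ≈⟨ ×-assocˡ z p d ⟨
      p × (d × z)   ≈⟨ p×≈0 (d × z) ⟩
      0#            ∎
    middle-term : ∀ i → t (Fin.suc (inject₁ i)) ≈ 0#
    middle-term i =
      divisible-term (prime∣C p-prime z<s (s<s (subst (ℕ._< suc r) (sym (toℕ-inject₁ i)) (toℕ<n i)))) _
    middle-terms : sum (Vecᶠ.init (Vecᶠ.tail t)) ≈ 0#
    middle-terms = ≈-trans (sum-cong-≋ middle-term) (sum-replicate-zero (suc r))

open import Algebra.Structures using (IsCommutativeSemiring; IsCommutativeMonoid)
open import Algebra.Structures.Biased using (IsCommutativeSemiringˡ; isCommutativeMonoidˡ)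
open import Data.Bool.Base using (Bool; true; false; if_then_else_; _∧_)
import Data.Integer.Base as ℤ
import Data.Integer.Divisibility as ℤ
import Data.Integer.Properties as ℤ
open import Data.List.Base as List using (List; []; _∷_; _++_; _∷ʳ_; concatMap; upTo; filterᵇ)
open import Data.List.Properties using (applyUpTo-∷ʳ)
import Data.List.Relation.Unary.All as ListAll
import Data.List.Relation.Unary.All.Properties as ListAll
open import Data.Maybe.Base using (just)
open import Data.Nat.Base using (_+_; _*_; _∸_; _≤_; _<_; _≥_; z≤n; s≤s; >-nonZero⁻¹; _%_; _/_; pred)
open import Data.Nat.DivMod using (m≡m%n+[m/n]*n; %-distribˡ-+; %-distribˡ-*; m<n⇒m%n≡m)
open import Data.Nat.Divisibility using (m∣m*n)
open import Data.Nat.ListAction using (sum; product)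
open import Data.Nat.Properties
open import Data.Nat.Tactic.RingSolver using (solve-∀)
open import Data.Product.Base using (_×_; _,_)
open import Data.Vec.Base as Vec using (Vec; []; _∷_; zipWith; map; replicate)
open import Data.Vec.Properties using (≡-dec; ∷-injective; zipWith-comm; zipWith-assoc; zipWith-identityˡ)
open import Data.Vec.Relation.Binary.Pointwise.Inductive as Pointwise using (Pointwise; []; _∷_)
open import Data.Vec.Relation.Unary.All using (All; []; _∷_)
open import Function.Base using (_∘_; id)
open import Level using (0ℓ)
open import Relation.Binary.Bundles using (Setoid)
open import Relation.Binary.Definitions using (Tri; tri<; tri≈; tri>)
open import Relation.Binary.Structures using (IsEquivalence)
open import Relation.Nullary.Decidable using (_×-dec_; isYes≗does)

open import Defs using (box; tuples; vsum; vecEqᵇ; binom; binomℤ; vsubℤ; toNatVec)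

⟦_⟧ : ∀ {a} {P : Set a} → Dec P → ℕ
⟦ yes _ ⟧ = 1
⟦ no _ ⟧ = 0

module _ {P : Set} where

  ⟦⟧-yes : (d : Dec P) → P → ⟦ d ⟧ ≡ 1
  ⟦⟧-yes (yes _) _ = refl
  ⟦⟧-yes (no ¬p) p = ⊥-elim (¬p p)

  ⟦⟧-no : (d : Dec P) → ¬ P → ⟦ d ⟧ ≡ 0
  ⟦⟧-no (yes p) ¬p = ⊥-elim (¬p p)
  ⟦⟧-no (no _) _ = refl

  ⟦⟧-guard : (d : Dec P) {x y : ℕ} → (P → x ≡ y) → ⟦ d ⟧ * x ≡ ⟦ d ⟧ * y
  ⟦⟧-guard (yes p) x≡y = cong (_+ 0) (x≡y p)
  ⟦⟧-guard (no _) _ = refl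

module _ {P Q : Set} where

  ⟦⟧-cong : (dP : Dec P) (dQ : Dec Q) → (P → Q) → (Q → P) → ⟦ dP ⟧ ≡ ⟦ dQ ⟧
  ⟦⟧-cong (yes p) dQ P⇒Q _ = sym (⟦⟧-yes dQ (P⇒Q p))
  ⟦⟧-cong (no ¬p) dQ _ Q⇒P = sym (⟦⟧-no dQ (¬p ∘ Q⇒P))

  ⟦⟧-× : (dP : Dec P) (dQ : Dec Q) → ⟦ dP ×-dec dQ ⟧ ≡ ⟦ dP ⟧ * ⟦ dQ ⟧
  ⟦⟧-× (yes _) (yes _) = refl
  ⟦⟧-× (yes _) (no _) = refl
  ⟦⟧-× (no _) _ = refl

  ⟦⟧-absorbˡ : (dP : Dec P) (dQ : Dec Q) → (Q → P) → ⟦ dP ⟧ * ⟦ dQ ⟧ ≡ ⟦ dQ ⟧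
  ⟦⟧-absorbˡ (yes _) dQ _ = +-identityʳ ⟦ dQ ⟧
  ⟦⟧-absorbˡ (no ¬p) dQ Q⇒P = sym (⟦⟧-no dQ (¬p ∘ Q⇒P))

∑ : ∀ {a} {A : Set a} → List A → (A → ℕ) → ℕ
∑ xs φ = sum (List.map φ xs)

infix 5 ∑
syntax ∑ xs (λ x → e) = ∑[ x ∈ xs ] e

module _ {a} {A : Set a} where

  ∑-cong : ∀ (xs : List A) {φ ψ : A → ℕ} → (∀ x → φ x ≡ ψ x) → ∑ xs φ ≡ ∑ xs ψ
  ∑-cong [] _ = refl
  ∑-cong (x ∷ xs) φ≗ψ = cong₂ _+_ (φ≗ψ x) (∑-cong xs φ≗ψ)

  ∑-cong-All : ∀ {P : A → Set} {xs : List A} → ListAll.All P xs → {φ ψ : A → ℕ} →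
               (∀ x → P x → φ x ≡ ψ x) → ∑ xs φ ≡ ∑ xs ψ
  ∑-cong-All ListAll.[] _ = refl
  ∑-cong-All {xs = x ∷ _} (px ListAll.∷ pxs) φ≗ψ = cong₂ _+_ (φ≗ψ x px) (∑-cong-All pxs φ≗ψ)

  ∑-++ : ∀ (xs ys : List A) φ → ∑ (xs ++ ys) φ ≡ ∑ xs φ + ∑ ys φ
  ∑-++ [] ys φ = refl
  ∑-++ (x ∷ xs) ys φ = trans (cong (φ x +_) (∑-++ xs ys φ)) (sym (+-assoc (φ x) _ _))

  ∑-0 : ∀ (xs : List A) → ∑[ x ∈ xs ] 0 ≡ 0
  ∑-0 [] = refl
  ∑-0 (_ ∷ xs) = ∑-0 xs

  ∑-+ : ∀ (xs : List A) φ ψ → ∑[ x ∈ xs ] (φ x + ψ x) ≡ ∑ xs φ + ∑ xs ψ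
  ∑-+ [] φ ψ = refl
  ∑-+ (x ∷ xs) φ ψ = trans (cong (φ x + ψ x +_) (∑-+ xs φ ψ)) (interchange (φ x) (ψ x) _ _)
    where open import Algebra.Properties.CommutativeSemigroup +-commutativeSemigroup using (interchange)

  *-distribˡ-∑ : ∀ c (xs : List A) φ → c * ∑ xs φ ≡ ∑[ x ∈ xs ] (c * φ x)
  *-distribˡ-∑ c [] φ = *-zeroʳ c
  *-distribˡ-∑ c (x ∷ xs) φ = trans (*-distribˡ-+ c (φ x) _) (cong (c * φ x +_) (*-distribˡ-∑ c xs φ))

  ∑-replicate : ∀ k (x : A) φ → ∑ (List.replicate k x) φ ≡ k * φ x
  ∑-replicate zero x φ = refl
  ∑-replicate (suc k) x φ = cong (φ x +_) (∑-replicate k x φ)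

  *-distribʳ-∑ : ∀ c (xs : List A) φ → ∑ xs φ * c ≡ ∑[ x ∈ xs ] (φ x * c)
  *-distribʳ-∑ c xs φ = trans (*-comm (∑ xs φ) c) (trans (*-distribˡ-∑ c xs φ) (∑-cong xs λ x → *-comm c (φ x)))

module _ {a b} {A : Set a} {B : Set b} where

  ∑-map : ∀ (f : A → B) (xs : List A) φ → ∑ (List.map f xs) φ ≡ ∑ xs (φ ∘ f)
  ∑-map f [] φ = refl
  ∑-map f (x ∷ xs) φ = cong (φ (f x) +_) (∑-map f xs φ)

  ∑-concatMap : ∀ (h : A → List B) (xs : List A) φ → ∑ (concatMap h xs) φ ≡ ∑[ x ∈ xs ] ∑ (h x) φ
  ∑-concatMap h [] φ = refl
  ∑-concatMap h (x ∷ xs) φ = trans (∑-++ (h x) (concatMap h xs) φ) (cong (∑ (h x) φ +_) (∑-concatMap h xs φ))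

  ∑-comm : ∀ (xs : List A) (ys : List B) (φ : A → B → ℕ) →
           ∑[ x ∈ xs ] ∑[ y ∈ ys ] φ x y ≡ ∑[ y ∈ ys ] ∑[ x ∈ xs ] φ x y
  ∑-comm [] ys φ = sym (∑-0 ys)
  ∑-comm (x ∷ xs) ys φ = trans (cong (∑ ys (φ x) +_) (∑-comm xs ys φ)) (sym (∑-+ ys (φ x) _))

infixl 6 _+ᵛ_ _∸ᵛ_
infixr 7 _·ᵛ_
infix 4 _≤ᵛ_ _≤ᵛ?_ _≟ᵛ_

_+ᵛ_ _∸ᵛ_ : ∀ {n} → Vec ℕ n → Vec ℕ n → Vec ℕ n
_+ᵛ_ = zipWith _+_
_∸ᵛ_ = zipWith _∸_

_·ᵛ_ : ∀ {n} → ℕ → Vec ℕ n → Vec ℕ n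
c ·ᵛ u = map (c *_) u

0ᵛ : ∀ {n} → Vec ℕ n
0ᵛ = replicate _ 0

_≤ᵛ_ : ∀ {n} → Vec ℕ n → Vec ℕ n → Set
_≤ᵛ_ = Pointwise _≤_

_≤ᵛ?_ : ∀ {n} (u v : Vec ℕ n) → Dec (u ≤ᵛ v)
_≤ᵛ?_ = Pointwise.decidable _≤?_

_≟ᵛ_ : ∀ {n} (u v : Vec ℕ n) → Dec (u ≡ v)
_≟ᵛ_ = ≡-dec _≟_

module _ {n : ℕ} where

  ≤ᵛ-refl : {u : Vec ℕ n} → u ≤ᵛ u
  ≤ᵛ-refl = Pointwise.refl ≤-refl

  ≤ᵛ-trans : {u v w : Vec ℕ n} → u ≤ᵛ v → v ≤ᵛ w → u ≤ᵛ w
  ≤ᵛ-trans = Pointwise.trans ≤-trans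

  ⟦≟ᵛ⟧-sym : (u v : Vec ℕ n) → ⟦ u ≟ᵛ v ⟧ ≡ ⟦ v ≟ᵛ u ⟧
  ⟦≟ᵛ⟧-sym u v = ⟦⟧-cong (u ≟ᵛ v) (v ≟ᵛ u) sym sym

  +ᵛ-comm : (u v : Vec ℕ n) → u +ᵛ v ≡ v +ᵛ u
  +ᵛ-comm = zipWith-comm +-comm

  +ᵛ-assoc : (u v w : Vec ℕ n) → (u +ᵛ v) +ᵛ w ≡ u +ᵛ (v +ᵛ w)
  +ᵛ-assoc = zipWith-assoc +-assoc

  +ᵛ-identityˡ : (u : Vec ℕ n) → 0ᵛ +ᵛ u ≡ u
  +ᵛ-identityˡ = zipWith-identityˡ +-identityˡ

0ᵛ≤ᵛ : ∀ {n} (u : Vec ℕ n) → 0ᵛ ≤ᵛ u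
0ᵛ≤ᵛ [] = []
0ᵛ≤ᵛ (_ ∷ u) = z≤n ∷ 0ᵛ≤ᵛ u

u≤ᵛu+ᵛv : ∀ {n} (u v : Vec ℕ n) → u ≤ᵛ u +ᵛ v
u≤ᵛu+ᵛv [] [] = []
u≤ᵛu+ᵛv (a ∷ u) (b ∷ v) = m≤m+n a b ∷ u≤ᵛu+ᵛv u v

x∸ᵛy≤ᵛx : ∀ {n} (x y : Vec ℕ n) → x ∸ᵛ y ≤ᵛ x
x∸ᵛy≤ᵛx [] [] = []
x∸ᵛy≤ᵛx (a ∷ x) (b ∷ y) = m∸n≤m a b ∷ x∸ᵛy≤ᵛx x y

u≤ᵛc·ᵛu : ∀ {n} c .{{_ : NonZero c}} (u : Vec ℕ n) → u ≤ᵛ c ·ᵛ u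
u≤ᵛc·ᵛu c [] = []
u≤ᵛc·ᵛu c (a ∷ u) = m≤n*m a c ∷ u≤ᵛc·ᵛu c u

+ᵛ-boundedˡ : ∀ {n} {u v y L : Vec ℕ n} → u +ᵛ v ≡ y → y ≤ᵛ L → u ≤ᵛ L
+ᵛ-boundedˡ {u = u} {v} refl = ≤ᵛ-trans (u≤ᵛu+ᵛv u v)

+ᵛ-boundedʳ : ∀ {n} {u v y L : Vec ℕ n} → u +ᵛ v ≡ y → y ≤ᵛ L → v ≤ᵛ L
+ᵛ-boundedʳ {u = u} {v} u+v≡y = +ᵛ-boundedˡ (trans (+ᵛ-comm v u) u+v≡y)

·ᵛ-bounded : ∀ {n} c .{{_ : NonZero c}} {u y L : Vec ℕ n} → c ·ᵛ u ≡ y → y ≤ᵛ L → u ≤ᵛ L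
·ᵛ-bounded c {u} refl = ≤ᵛ-trans (u≤ᵛc·ᵛu c u)

·ᵛ-distrib-+ᵛ : ∀ {n} c (u v : Vec ℕ n) → c ·ᵛ (u +ᵛ v) ≡ c ·ᵛ u +ᵛ c ·ᵛ v
·ᵛ-distrib-+ᵛ c [] [] = refl
·ᵛ-distrib-+ᵛ c (a ∷ u) (b ∷ v) = cong₂ _∷_ (*-distribˡ-+ c a b) (·ᵛ-distrib-+ᵛ c u v)

·ᵛ-suc : ∀ {n} k (u : Vec ℕ n) → suc k ·ᵛ u ≡ u +ᵛ k ·ᵛ u
·ᵛ-suc k [] = refl
·ᵛ-suc k (a ∷ u) = cong (a + k * a ∷_) (·ᵛ-suc k u)

·ᵛ-zeroˡ : ∀ {n} (u : Vec ℕ n) → 0 ·ᵛ u ≡ 0ᵛ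
·ᵛ-zeroˡ [] = refl
·ᵛ-zeroˡ (_ ∷ u) = cong (0 ∷_) (·ᵛ-zeroˡ u)

·ᵛ-zeroʳ : ∀ {n} c → c ·ᵛ 0ᵛ {n} ≡ 0ᵛ
·ᵛ-zeroʳ {zero} c = refl
·ᵛ-zeroʳ {suc n} c = cong₂ _∷_ (*-zeroʳ c) (·ᵛ-zeroʳ c)

∸ᵛ-flip : ∀ {n} {x m j : Vec ℕ n} → m ≤ᵛ x → x ∸ᵛ m ≡ j → x ∸ᵛ j ≡ m
∸ᵛ-flip {x = a ∷ x} {b ∷ m} (b≤a ∷ m≤x) refl = cong₂ _∷_ (m∸[m∸n]≡n b≤a) (∸ᵛ-flip m≤x refl)
∸ᵛ-flip [] refl = refl

∑-box-∷ : ∀ {n} a (L : Vec ℕ n) φ → ∑ (box (a ∷ L)) φ ≡ ∑[ i ∈ upTo (suc a) ] ∑[ m ∈ box L ] φ (i ∷ m)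
∑-box-∷ a L φ = trans (∑-concatMap (λ i → List.map (i ∷_) (box L)) (upTo (suc a)) φ)
                      (∑-cong (upTo (suc a)) λ i → ∑-map (i ∷_) (box L) φ)

box-bounded : ∀ {n} (L : Vec ℕ n) → ListAll.All (_≤ᵛ L) (box L)
box-bounded [] = [] ListAll.∷ ListAll.[]
box-bounded (a ∷ L) = ListAll.concat⁺ (ListAll.map⁺ (ListAll.applyUpTo⁺₁ id (suc a) λ i<1+a →
  ListAll.map⁺ (ListAll.map (≤-pred i<1+a ∷_) (box-bounded L))))

∑-upTo-≟ : ∀ b n → ∑[ i ∈ upTo n ] ⟦ b ≟ i ⟧ ≡ ⟦ b <? n ⟧
∑-upTo-≟ b zero = sym (⟦⟧-no (b <? 0) λ ())
∑-upTo-≟ b (suc n) = begin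
  ∑[ i ∈ upTo (suc n) ] ⟦ b ≟ i ⟧                ≡⟨ cong (λ is → ∑[ i ∈ is ] ⟦ b ≟ i ⟧) (applyUpTo-∷ʳ id n) ⟨
  ∑[ i ∈ upTo n ∷ʳ n ] ⟦ b ≟ i ⟧                 ≡⟨ ∑-++ (upTo n) (n ∷ []) _ ⟩
  (∑[ i ∈ upTo n ] ⟦ b ≟ i ⟧) + (⟦ b ≟ n ⟧ + 0)  ≡⟨ cong₂ _+_ (∑-upTo-≟ b n) (+-identityʳ _) ⟩
  ⟦ b <? n ⟧ + ⟦ b ≟ n ⟧                         ≡⟨ split (<-cmp b n) ⟩
  ⟦ b <? suc n ⟧                                 ∎
  where
  open ≡-Reasoning
  split : Tri (b < n) (b ≡ n) (n < b) → ⟦ b <? n ⟧ + ⟦ b ≟ n ⟧ ≡ ⟦ b <? suc n ⟧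
  split (tri< b<n b≢n _) rewrite ⟦⟧-yes (b <? n) b<n | ⟦⟧-no (b ≟ n) b≢n
                              | ⟦⟧-yes (b <? suc n) (m<n⇒m<1+n b<n) = refl
  split (tri≈ b≮n refl _) rewrite ⟦⟧-no (b <? n) b≮n | ⟦⟧-yes (b ≟ n) refl
                              | ⟦⟧-yes (b <? suc n) ≤-refl = refl
  split (tri> b≮n b≢n b>n) rewrite ⟦⟧-no (b <? n) b≮n | ⟦⟧-no (b ≟ n) b≢n
                              | ⟦⟧-no (b <? suc n) (<⇒≱ b>n ∘ ≤-pred) = refl

∑-box-≟ : ∀ {n} (L u : Vec ℕ n) → ∑[ m ∈ box L ] ⟦ u ≟ᵛ m ⟧ ≡ ⟦ u ≤ᵛ? L ⟧
∑-box-≟ [] [] = refl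
∑-box-≟ (a ∷ L) (b ∷ u) = begin
  ∑[ m ∈ box (a ∷ L) ] ⟦ b ∷ u ≟ᵛ m ⟧
    ≡⟨ ∑-box-∷ a L _ ⟩
  ∑[ i ∈ upTo (suc a) ] ∑[ m ∈ box L ] ⟦ b ∷ u ≟ᵛ i ∷ m ⟧
    ≡⟨ ∑-cong (upTo (suc a)) (λ i → trans (∑-cong (box L) λ m → split-≟ i m)
                                           (sym (*-distribˡ-∑ ⟦ b ≟ i ⟧ (box L) _))) ⟩
  ∑[ i ∈ upTo (suc a) ] ⟦ b ≟ i ⟧ * (∑[ m ∈ box L ] ⟦ u ≟ᵛ m ⟧)
    ≡⟨ *-distribʳ-∑ (∑[ m ∈ box L ] ⟦ u ≟ᵛ m ⟧) (upTo (suc a)) (λ i → ⟦ b ≟ i ⟧) ⟨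
  (∑[ i ∈ upTo (suc a) ] ⟦ b ≟ i ⟧) * (∑[ m ∈ box L ] ⟦ u ≟ᵛ m ⟧)
    ≡⟨ cong₂ _*_ (∑-upTo-≟ b (suc a)) (∑-box-≟ L u) ⟩
  ⟦ b <? suc a ⟧ * ⟦ u ≤ᵛ? L ⟧
    ≡⟨ ⟦⟧-× (b <? suc a) (u ≤ᵛ? L) ⟨
  ⟦ (b <? suc a) ×-dec (u ≤ᵛ? L) ⟧
    ≡⟨ ⟦⟧-cong _ (b ∷ u ≤ᵛ? a ∷ L) (λ (b<1+a , u≤L) → ≤-pred b<1+a ∷ u≤L)
                                   (λ { (b≤a ∷ u≤L) → s≤s b≤a , u≤L }) ⟩
  ⟦ b ∷ u ≤ᵛ? a ∷ L ⟧ ∎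
  where
  open ≡-Reasoning
  split-≟ : ∀ i m → ⟦ b ∷ u ≟ᵛ i ∷ m ⟧ ≡ ⟦ b ≟ i ⟧ * ⟦ u ≟ᵛ m ⟧
  split-≟ i m = trans (⟦⟧-cong (b ∷ u ≟ᵛ i ∷ m) ((b ≟ i) ×-dec (u ≟ᵛ m))
                                ∷-injective (λ (b≡i , u≡m) → cong₂ _∷_ b≡i u≡m))
                      (⟦⟧-× (b ≟ i) (u ≟ᵛ m))

module _ {n : ℕ} (L : Vec ℕ n) where

  ∑-box-pick : ∀ u (ψ : Vec ℕ n → ℕ) → ∑[ m ∈ box L ] ⟦ u ≟ᵛ m ⟧ * ψ m ≡ ⟦ u ≤ᵛ? L ⟧ * ψ u
  ∑-box-pick u ψ = begin
    ∑[ m ∈ box L ] ⟦ u ≟ᵛ m ⟧ * ψ m ≡⟨ ∑-cong (box L) (λ m → ⟦⟧-guard (u ≟ᵛ m) λ u≡m → cong ψ (sym u≡m)) ⟩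
    ∑[ m ∈ box L ] ⟦ u ≟ᵛ m ⟧ * ψ u ≡⟨ *-distribʳ-∑ (ψ u) (box L) _ ⟨
    (∑[ m ∈ box L ] ⟦ u ≟ᵛ m ⟧) * ψ u ≡⟨ cong (_* ψ u) (∑-box-≟ L u) ⟩
    ⟦ u ≤ᵛ? L ⟧ * ψ u               ∎
    where open ≡-Reasoning

  ∑-box-pick-≤ : ∀ {u} (ψ : Vec ℕ n → ℕ) → u ≤ᵛ L → ∑[ m ∈ box L ] ⟦ u ≟ᵛ m ⟧ * ψ m ≡ ψ u
  ∑-box-pick-≤ {u} ψ u≤L =
    trans (∑-box-pick u ψ) (trans (cong (_* ψ u) (⟦⟧-yes (u ≤ᵛ? L) u≤L)) (+-identityʳ (ψ u)))

  ∑-box-pick-guarded : ∀ u {Q : Vec ℕ n → Set} (D : ∀ m → Dec (Q m)) (ψ : Vec ℕ n → ℕ) →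
                       (Q u → u ≤ᵛ L) →
                       ∑[ m ∈ box L ] ⟦ u ≟ᵛ m ⟧ * (⟦ D m ⟧ * ψ m) ≡ ⟦ D u ⟧ * ψ u
  ∑-box-pick-guarded u D ψ Q⇒u≤L = begin
    ∑[ m ∈ box L ] ⟦ u ≟ᵛ m ⟧ * (⟦ D m ⟧ * ψ m) ≡⟨ ∑-box-pick u _ ⟩
    ⟦ u ≤ᵛ? L ⟧ * (⟦ D u ⟧ * ψ u)               ≡⟨ *-assoc ⟦ u ≤ᵛ? L ⟧ _ _ ⟨
    ⟦ u ≤ᵛ? L ⟧ * ⟦ D u ⟧ * ψ u                 ≡⟨ cong (_* ψ u) (⟦⟧-absorbˡ (u ≤ᵛ? L) (D u) Q⇒u≤L) ⟩
    ⟦ D u ⟧ * ψ u                               ∎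
    where open ≡-Reasoning

  ∑-box-pick-⟦⟧ : ∀ u {Q : Vec ℕ n → Set} (D : ∀ m → Dec (Q m)) → (Q u → u ≤ᵛ L) →
                  ∑[ m ∈ box L ] ⟦ u ≟ᵛ m ⟧ * ⟦ D m ⟧ ≡ ⟦ D u ⟧
  ∑-box-pick-⟦⟧ u D Q⇒u≤L = trans (∑-box-pick u _) (⟦⟧-absorbˡ (u ≤ᵛ? L) (D u) Q⇒u≤L)

  ∑-box-pushforward : ∀ {a} {X : Set a} (xs : List X) (s : X → Vec ℕ n) (w : X → ℕ)
                      {Q : Vec ℕ n → Set} (D : ∀ m → Dec (Q m)) → (∀ {m} → Q m → m ≤ᵛ L) →
                      (ψ : Vec ℕ n → ℕ) →
                      ∑[ m ∈ box L ] ⟦ D m ⟧ * (ψ m * (∑[ x ∈ xs ] ⟦ s x ≟ᵛ m ⟧ * w x))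
                      ≡ ∑[ x ∈ xs ] ⟦ D (s x) ⟧ * (ψ (s x) * w x)
  ∑-box-pushforward xs s w D Q⇒≤L ψ = begin
    ∑[ m ∈ box L ] ⟦ D m ⟧ * (ψ m * (∑[ x ∈ xs ] ⟦ s x ≟ᵛ m ⟧ * w x))
      ≡⟨ ∑-cong (box L) (λ m → trans (sym (*-assoc ⟦ D m ⟧ (ψ m) _))
                             (trans (*-distribˡ-∑ (⟦ D m ⟧ * ψ m) xs _)
                                    (∑-cong xs λ x → shuffle ⟦ D m ⟧ (ψ m) ⟦ s x ≟ᵛ m ⟧ (w x)))) ⟩
    ∑[ m ∈ box L ] ∑[ x ∈ xs ] ⟦ s x ≟ᵛ m ⟧ * (⟦ D m ⟧ * (ψ m * w x))
      ≡⟨ ∑-comm (box L) xs _ ⟩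
    ∑[ x ∈ xs ] ∑[ m ∈ box L ] ⟦ s x ≟ᵛ m ⟧ * (⟦ D m ⟧ * (ψ m * w x))
      ≡⟨ ∑-cong xs (λ x → ∑-box-pick-guarded (s x) D (λ m → ψ m * w x) Q⇒≤L) ⟩
    ∑[ x ∈ xs ] ⟦ D (s x) ⟧ * (ψ (s x) * w x) ∎
    where
    open ≡-Reasoning
    shuffle : ∀ u v e z → u * v * (e * z) ≡ e * (u * (v * z))
    shuffle = solve-∀

  ∑-box-restrict : ∀ {y} → y ≤ᵛ L → (φ : Vec ℕ n → ℕ) →
                   ∑[ m ∈ box L ] ⟦ m ≤ᵛ? y ⟧ * φ m ≡ ∑ (box y) φ
  ∑-box-restrict {y} y≤L φ = begin
    ∑[ m ∈ box L ] ⟦ m ≤ᵛ? y ⟧ * φ m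
      ≡⟨ ∑-cong (box L) (λ m → cong (_* φ m) (∑-box-≟ y m)) ⟨
    ∑[ m ∈ box L ] (∑[ a ∈ box y ] ⟦ m ≟ᵛ a ⟧) * φ m
      ≡⟨ ∑-cong (box L) (λ m → trans (*-distribʳ-∑ (φ m) (box y) _)
                                     (∑-cong (box y) λ a → cong (_* φ m) (⟦≟ᵛ⟧-sym m a))) ⟩
    ∑[ m ∈ box L ] ∑[ a ∈ box y ] ⟦ a ≟ᵛ m ⟧ * φ m
      ≡⟨ ∑-comm (box L) (box y) _ ⟩
    ∑[ a ∈ box y ] ∑[ m ∈ box L ] ⟦ a ≟ᵛ m ⟧ * φ m
      ≡⟨ ∑-cong-All (box-bounded y) (λ a a≤y → ∑-box-pick-≤ φ (≤ᵛ-trans a≤y y≤L)) ⟩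
    ∑ (box y) φ ∎
    where open ≡-Reasoning

∑-box-reflect : ∀ {n} (x : Vec ℕ n) (φ : Vec ℕ n → ℕ) → ∑[ m ∈ box x ] φ (x ∸ᵛ m) ≡ ∑ (box x) φ
∑-box-reflect x φ = begin
  ∑[ m ∈ box x ] φ (x ∸ᵛ m)
    ≡⟨ ∑-cong (box x) (λ m → ∑-box-pick-≤ x φ (x∸ᵛy≤ᵛx x m)) ⟨
  ∑[ m ∈ box x ] ∑[ j ∈ box x ] ⟦ x ∸ᵛ m ≟ᵛ j ⟧ * φ j
    ≡⟨ ∑-comm (box x) (box x) _ ⟩
  ∑[ j ∈ box x ] ∑[ m ∈ box x ] ⟦ x ∸ᵛ m ≟ᵛ j ⟧ * φ j
    ≡⟨ ∑-cong-All (box-bounded x) (λ j j≤x →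
         trans (∑-cong-All (box-bounded x) λ m m≤x → cong (_* φ j) (flip m≤x j≤x))
               (∑-box-pick-≤ x (λ _ → φ j) (x∸ᵛy≤ᵛx x j))) ⟩
  ∑ (box x) φ ∎
  where
  open ≡-Reasoning
  flip : ∀ {m j} → m ≤ᵛ x → j ≤ᵛ x → ⟦ x ∸ᵛ m ≟ᵛ j ⟧ ≡ ⟦ x ∸ᵛ j ≟ᵛ m ⟧
  flip m≤x j≤x = ⟦⟧-cong (_ ≟ᵛ _) (_ ≟ᵛ _) (∸ᵛ-flip m≤x) (∸ᵛ-flip j≤x)

∑-filterᵇ : ∀ {a} {A : Set a} (P : A → Bool) (φ : A → ℕ) xs →
            sum (List.map φ (filterᵇ P xs)) ≡ ∑[ x ∈ xs ] (if P x then φ x else 0)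
∑-filterᵇ P φ [] = refl
∑-filterᵇ P φ (x ∷ xs) with P x
... | true = cong (φ x +_) (∑-filterᵇ P φ xs)
... | false = ∑-filterᵇ P φ xs

if-does : ∀ {P : Set} (d : Dec P) c → (if does d then c else 0) ≡ ⟦ d ⟧ * c
if-does (yes _) c = sym (+-identityʳ c)
if-does (no _) c = refl

vecEqᵇ≡does : ∀ {n} (u v : Vec ℕ n) → vecEqᵇ u v ≡ does (u ≟ᵛ v)
vecEqᵇ≡does [] [] = refl
vecEqᵇ≡does (a ∷ u) (b ∷ v) = cong₂ _∧_ (isYes≗does (a ≟ b)) (vecEqᵇ≡does u v)

∑-tuples-suc : ∀ {n} k (B : Vec ℕ n) (Φ : List (Vec ℕ n) → ℕ) →
               ∑ (tuples (suc k) B) Φ ≡ ∑[ m ∈ box B ] ∑[ ms ∈ tuples k B ] Φ (m ∷ ms)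
∑-tuples-suc k B Φ = trans (∑-concatMap (λ m → List.map (m ∷_) (tuples k B)) (box B) Φ)
                           (∑-cong (box B) λ m → ∑-map (m ∷_) (tuples k B) Φ)

allBelow : ∀ {n} → Vec ℕ n → List (Vec ℕ n) → ℕ
allBelow y ms = product (List.map (λ m → ⟦ m ≤ᵛ? y ⟧) ms)

allBelow-vsum : ∀ {n} {y : Vec ℕ n} ms → vsum ms ≤ᵛ y → allBelow y ms ≡ 1
allBelow-vsum [] _ = refl
allBelow-vsum {y = y} (m ∷ ms) m+ms≤y =
  cong₂ _*_ (⟦⟧-yes (m ≤ᵛ? y) (+ᵛ-boundedˡ refl m+ms≤y)) (allBelow-vsum ms (+ᵛ-boundedʳ {u = m} refl m+ms≤y))

∑-tuples-restrict : ∀ {n} {y L : Vec ℕ n} → y ≤ᵛ L → ∀ k (Φ : List (Vec ℕ n) → ℕ) →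
                    ∑[ ms ∈ tuples k L ] allBelow y ms * Φ ms ≡ ∑ (tuples k y) Φ
∑-tuples-restrict y≤L zero Φ = cong (_+ 0) (*-identityˡ (Φ []))
∑-tuples-restrict {y = y} {L} y≤L (suc k) Φ = begin
  ∑[ ms ∈ tuples (suc k) L ] allBelow y ms * Φ ms
    ≡⟨ ∑-tuples-suc k L _ ⟩
  ∑[ m ∈ box L ] ∑[ ms ∈ tuples k L ] ⟦ m ≤ᵛ? y ⟧ * allBelow y ms * Φ (m ∷ ms)
    ≡⟨ ∑-cong (box L) (λ m → trans (∑-cong (tuples k L) λ ms → *-assoc ⟦ m ≤ᵛ? y ⟧ _ _)
                                   (sym (*-distribˡ-∑ ⟦ m ≤ᵛ? y ⟧ (tuples k L) _))) ⟩
  ∑[ m ∈ box L ] ⟦ m ≤ᵛ? y ⟧ * (∑[ ms ∈ tuples k L ] allBelow y ms * Φ (m ∷ ms))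
    ≡⟨ ∑-cong (box L) (λ m → cong (⟦ m ≤ᵛ? y ⟧ *_) (∑-tuples-restrict y≤L k (Φ ∘ (m ∷_)))) ⟩
  ∑[ m ∈ box L ] ⟦ m ≤ᵛ? y ⟧ * (∑[ ms ∈ tuples k y ] Φ (m ∷ ms))
    ≡⟨ ∑-box-restrict L y≤L _ ⟩
  ∑[ m ∈ box y ] ∑[ ms ∈ tuples k y ] Φ (m ∷ ms)
    ≡⟨ ∑-tuples-suc k y Φ ⟨
  ∑ (tuples (suc k) y) Φ ∎
  where open ≡-Reasoning

module _ {n} (f : Vec ℕ n → ℕ) where

  binomWithin : Vec ℕ n → ℕ → Vec ℕ n → ℕ
  binomWithin B k y = ∑[ ms ∈ tuples k B ] ⟦ vsum ms ≟ᵛ y ⟧ * product (List.map f ms)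

  binom≡binomWithin : ∀ k y → binom f k y ≡ binomWithin y k y
  binom≡binomWithin k y = trans (∑-filterᵇ (λ ms → vecEqᵇ (vsum ms) y) _ (tuples k y))
    (∑-cong (tuples k y) λ ms → trans (cong (λ b → if b then _ else 0) (vecEqᵇ≡does (vsum ms) y))
                                     (if-does (vsum ms ≟ᵛ y) _))

  binomWithin-restrict : ∀ {y L} → y ≤ᵛ L → ∀ k → binomWithin L k y ≡ binomWithin y k y
  binomWithin-restrict {y} {L} y≤L k = trans (∑-cong (tuples k L) insert-allBelow) (∑-tuples-restrict y≤L k term)
    where
    term : List (Vec ℕ n) → ℕ
    term ms = ⟦ vsum ms ≟ᵛ y ⟧ * product (List.map f ms)
    insert-allBelow : ∀ ms → term ms ≡ allBelow y ms * term ms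
    insert-allBelow ms with vsum ms ≟ᵛ y
    ... | yes refl = sym (trans (cong (_* (1 * product (List.map f ms))) (allBelow-vsum ms ≤ᵛ-refl)) (*-identityˡ _))
    ... | no _ = sym (*-zeroʳ (allBelow y ms))

module Modulo (q : ℕ) .{{_ : NonZero q}} where

  open import Data.Nat.Divisibility using (_∣_; divides; n∣m⇒m%n≡0)

  infix 4 _≡ₘ_

  -- A record rather than a synonym, so that a and b can be inferred from a proof.
  record _≡ₘ_ (a b : ℕ) : Set where
    constructor mk≡ₘ
    field %-≡ : a % q ≡ b % q

  ≡ₘ-reflexive : ∀ {a b} → a ≡ b → a ≡ₘ b
  ≡ₘ-reflexive a≡b = mk≡ₘ (cong (_% q) a≡b)

  ≡ₘ-refl : ∀ {a} → a ≡ₘ a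
  ≡ₘ-refl = mk≡ₘ refl

  ≡ₘ-sym : ∀ {a b} → a ≡ₘ b → b ≡ₘ a
  ≡ₘ-sym (mk≡ₘ e) = mk≡ₘ (sym e)

  ≡ₘ-trans : ∀ {a b c} → a ≡ₘ b → b ≡ₘ c → a ≡ₘ c
  ≡ₘ-trans (mk≡ₘ e) (mk≡ₘ e′) = mk≡ₘ (trans e e′)

  ≡ₘ-setoid : Setoid 0ℓ 0ℓ
  ≡ₘ-setoid = record
    { Carrier = ℕ
    ; _≈_ = _≡ₘ_
    ; isEquivalence = record { refl = ≡ₘ-refl ; sym = ≡ₘ-sym ; trans = ≡ₘ-trans }
    }

  +-cong-≡ₘ : ∀ {a a′ b b′} → a ≡ₘ a′ → b ≡ₘ b′ → a + b ≡ₘ a′ + b′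
  +-cong-≡ₘ {a} {a′} {b} {b′} (mk≡ₘ e) (mk≡ₘ e′) =
    mk≡ₘ (trans (%-distribˡ-+ a b q) (trans (cong₂ (λ x y → (x + y) % q) e e′) (sym (%-distribˡ-+ a′ b′ q))))

  *-cong-≡ₘ : ∀ {a a′ b b′} → a ≡ₘ a′ → b ≡ₘ b′ → a * b ≡ₘ a′ * b′
  *-cong-≡ₘ {a} {a′} {b} {b′} (mk≡ₘ e) (mk≡ₘ e′) =
    mk≡ₘ (trans (%-distribˡ-* a b q) (trans (cong₂ (λ x y → (x * y) % q) e e′) (sym (%-distribˡ-* a′ b′ q))))

  ∣⇒≡ₘ0 : ∀ {a} → q ∣ a → a ≡ₘ 0
  ∣⇒≡ₘ0 {a} q∣a = mk≡ₘ (trans (n∣m⇒m%n≡0 a q q∣a) (sym (m<n⇒m%n≡m (>-nonZero⁻¹ q))))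

  ⟦⟧-guard-≡ₘ : ∀ {P : Set} (d : Dec P) {x y} → (P → x ≡ₘ y) → ⟦ d ⟧ * x ≡ₘ ⟦ d ⟧ * y
  ⟦⟧-guard-≡ₘ (yes p) x≡y = +-cong-≡ₘ (x≡y p) ≡ₘ-refl
  ⟦⟧-guard-≡ₘ (no _) _ = ≡ₘ-refl

  ∑-cong-≡ₘ : ∀ {a} {A : Set a} (xs : List A) {φ ψ : A → ℕ} → (∀ x → φ x ≡ₘ ψ x) → ∑ xs φ ≡ₘ ∑ xs ψ
  ∑-cong-≡ₘ [] _ = ≡ₘ-refl
  ∑-cong-≡ₘ (x ∷ xs) φ≡ψ = +-cong-≡ₘ (φ≡ψ x) (∑-cong-≡ₘ xs φ≡ψ)

  ≡ₘ⇒∣∸ : ∀ {a b} → b ≤ a → a ≡ₘ b → q ∣ a ∸ b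
  ≡ₘ⇒∣∸ {a} {b} _ (mk≡ₘ e) = divides (a / q ∸ b / q) (begin
    a ∸ b                                    ≡⟨ cong₂ _∸_ (m≡m%n+[m/n]*n a q) (m≡m%n+[m/n]*n b q) ⟩
    (a % q + a / q * q) ∸ (b % q + b / q * q) ≡⟨ cong (λ r → (a % q + a / q * q) ∸ (r + b / q * q)) e ⟨
    (a % q + a / q * q) ∸ (a % q + b / q * q) ≡⟨ [m+n]∸[m+o]≡n∸o (a % q) _ _ ⟩
    a / q * q ∸ b / q * q                    ≡⟨ *-distribʳ-∸ q (a / q) (b / q) ⟨
    (a / q ∸ b / q) * q                      ∎)
    where open ≡-Reasoning

  ≡ₘ⇒∣- : ∀ {a b} → a ≡ₘ b → (ℤ.+ q) ℤ.∣ (ℤ.+ a ℤ.- ℤ.+ b)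
  ≡ₘ⇒∣- {a} {b} a≡b rewrite ℤ.m-n≡m⊖n a b with ≤-total b a
  ... | inj₁ b≤a rewrite ℤ.⊖-≥ b≤a = ≡ₘ⇒∣∸ b≤a a≡b
  ... | inj₂ a≤b rewrite ℤ.∣m⊖n∣≡∣n⊖m∣ a b | ℤ.⊖-≥ a≤b = ≡ₘ⇒∣∸ a≤b (≡ₘ-sym a≡b)

module Convolution {n : ℕ} (L : Vec ℕ n) where

  Series : Set
  Series = Vec ℕ n → ℕ

  infix 4 _≐_
  infixl 6 _⊕_
  infixl 7 _⊛_

  _≐_ : Series → Series → Set
  g ≐ h = ∀ y → y ≤ᵛ L → g y ≡ h y

  _⊕_ _⊛_ : Series → Series → Series
  (g ⊕ h) y = g y + h y
  (g ⊛ h) y = ∑[ a ∈ box L ] ∑[ b ∈ box L ] ⟦ a +ᵛ b ≟ᵛ y ⟧ * (g a * h b)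

  𝟘 : Series
  𝟘 _ = 0

  δ : Vec ℕ n → Series
  δ a y = ⟦ a ≟ᵛ y ⟧

  𝟙 : Series
  𝟙 = δ 0ᵛ

  ⊛-comm : ∀ g h y → (g ⊛ h) y ≡ (h ⊛ g) y
  ⊛-comm g h y = trans (∑-comm (box L) (box L) _) (∑-cong (box L) λ b → ∑-cong (box L) λ a →
    cong₂ _*_ (⟦⟧-cong (a +ᵛ b ≟ᵛ y) (b +ᵛ a ≟ᵛ y) (trans (+ᵛ-comm b a)) (trans (+ᵛ-comm a b)))
              (*-comm (g a) (h b)))

  ⊛-zeroˡ : ∀ g y → (𝟘 ⊛ g) y ≡ 0
  ⊛-zeroˡ g y =
    trans (∑-cong (box L) λ a → trans (∑-cong (box L) λ b → *-zeroʳ ⟦ a +ᵛ b ≟ᵛ y ⟧) (∑-0 (box L)))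
          (∑-0 (box L))

  ⊛-distribʳ : ∀ k g h y → ((g ⊕ h) ⊛ k) y ≡ (g ⊛ k ⊕ h ⊛ k) y
  ⊛-distribʳ k g h y =
    trans (∑-cong (box L) λ a → trans (∑-cong (box L) λ b → distrib ⟦ a +ᵛ b ≟ᵛ y ⟧ (g a) (h a) (k b))
                                      (∑-+ (box L) _ _))
          (∑-+ (box L) _ _)
    where
    distrib : ∀ e x z w → e * ((x + z) * w) ≡ e * (x * w) + e * (z * w)
    distrib = solve-∀

  ⊛-identityˡ : ∀ g → 𝟙 ⊛ g ≐ g
  ⊛-identityˡ g y y≤L = begin
    ∑[ a ∈ box L ] ∑[ b ∈ box L ] ⟦ a +ᵛ b ≟ᵛ y ⟧ * (⟦ 0ᵛ ≟ᵛ a ⟧ * g b)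
      ≡⟨ ∑-comm (box L) (box L) _ ⟩
    ∑[ b ∈ box L ] ∑[ a ∈ box L ] ⟦ a +ᵛ b ≟ᵛ y ⟧ * (⟦ 0ᵛ ≟ᵛ a ⟧ * g b)
      ≡⟨ ∑-cong (box L) (λ b → ∑-cong (box L) λ a → *-comm-middle ⟦ a +ᵛ b ≟ᵛ y ⟧ ⟦ 0ᵛ ≟ᵛ a ⟧ (g b)) ⟩
    ∑[ b ∈ box L ] ∑[ a ∈ box L ] ⟦ 0ᵛ ≟ᵛ a ⟧ * (⟦ a +ᵛ b ≟ᵛ y ⟧ * g b)
      ≡⟨ ∑-cong (box L) (λ b → ∑-box-pick-≤ L (λ a → ⟦ a +ᵛ b ≟ᵛ y ⟧ * g b) (0ᵛ≤ᵛ L)) ⟩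
    ∑[ b ∈ box L ] ⟦ 0ᵛ +ᵛ b ≟ᵛ y ⟧ * g b
      ≡⟨ ∑-cong (box L) (λ b → cong (_* g b) (⟦⟧-cong (0ᵛ +ᵛ b ≟ᵛ y) (y ≟ᵛ b)
           (λ e → sym (trans (sym (+ᵛ-identityˡ b)) e)) (λ e → trans (+ᵛ-identityˡ b) (sym e)))) ⟩
    ∑[ b ∈ box L ] ⟦ y ≟ᵛ b ⟧ * g b
      ≡⟨ ∑-box-pick-≤ L g y≤L ⟩
    g y ∎
    where
    open ≡-Reasoning
    *-comm-middle : ∀ x u z → x * (u * z) ≡ u * (x * z)
    *-comm-middle = solve-∀

  ∑-⊛ : ∀ {Q : Vec ℕ n → Set} (D : ∀ m → Dec (Q m)) → (∀ {m} → Q m → m ≤ᵛ L) → ∀ (ψ g h : Series) →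
        ∑[ m ∈ box L ] ⟦ D m ⟧ * (ψ m * (g ⊛ h) m)
        ≡ ∑[ a ∈ box L ] ∑[ b ∈ box L ] ⟦ D (a +ᵛ b) ⟧ * (ψ (a +ᵛ b) * (g a * h b))
  ∑-⊛ D Q⇒≤L ψ g h = begin
    ∑[ m ∈ B ] ⟦ D m ⟧ * (ψ m * (g ⊛ h) m)
      ≡⟨ ∑-cong B (λ m → trans (sym (*-assoc ⟦ D m ⟧ (ψ m) _)) (*-distribˡ-∑ (⟦ D m ⟧ * ψ m) B _)) ⟩
    ∑[ m ∈ B ] ∑[ a ∈ B ] ⟦ D m ⟧ * ψ m * (∑[ b ∈ B ] ⟦ a +ᵛ b ≟ᵛ m ⟧ * (g a * h b))
      ≡⟨ ∑-comm B B _ ⟩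
    ∑[ a ∈ B ] ∑[ m ∈ B ] ⟦ D m ⟧ * ψ m * (∑[ b ∈ B ] ⟦ a +ᵛ b ≟ᵛ m ⟧ * (g a * h b))
      ≡⟨ ∑-cong B (λ a → trans (∑-cong B λ m → *-assoc ⟦ D m ⟧ (ψ m) _)
                               (∑-box-pushforward L B (a +ᵛ_) (λ b → g a * h b) D Q⇒≤L ψ)) ⟩
    ∑[ a ∈ B ] ∑[ b ∈ B ] ⟦ D (a +ᵛ b) ⟧ * (ψ (a +ᵛ b) * (g a * h b)) ∎
    where
    open ≡-Reasoning
    B : List (Vec ℕ n)
    B = box L

  ⊛-assoc : ∀ g h k → (g ⊛ h) ⊛ k ≐ g ⊛ (h ⊛ k)
  ⊛-assoc g h k y y≤L = begin
    ∑[ a ∈ B ] ∑[ b ∈ B ] ⟦ a +ᵛ b ≟ᵛ y ⟧ * ((g ⊛ h) a * k b)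
      ≡⟨ trans (∑-comm B B _) (∑-cong B λ b → ∑-cong B λ a →
           cong (⟦ a +ᵛ b ≟ᵛ y ⟧ *_) (*-comm ((g ⊛ h) a) (k b))) ⟩
    ∑[ b ∈ B ] ∑[ a ∈ B ] ⟦ a +ᵛ b ≟ᵛ y ⟧ * (k b * (g ⊛ h) a)
      ≡⟨ ∑-cong B (λ b → ∑-⊛ (λ a → a +ᵛ b ≟ᵛ y) (λ e → +ᵛ-boundedˡ e y≤L) (λ _ → k b) g h) ⟩
    ∑[ b ∈ B ] ∑[ c ∈ B ] ∑[ d ∈ B ] ⟦ c +ᵛ d +ᵛ b ≟ᵛ y ⟧ * (k b * (g c * h d))
      ≡⟨ trans (∑-comm B B _) (∑-cong B λ c → ∑-comm B B _) ⟩
    ∑[ c ∈ B ] ∑[ d ∈ B ] ∑[ b ∈ B ] ⟦ c +ᵛ d +ᵛ b ≟ᵛ y ⟧ * (k b * (g c * h d))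
      ≡⟨ ∑-cong B (λ c → ∑-cong B λ d → ∑-cong B λ b → cong₂ _*_
           (⟦⟧-cong (_ ≟ᵛ y) (_ ≟ᵛ y) (trans (sym (+ᵛ-assoc c d b))) (trans (+ᵛ-assoc c d b)))
           (rearrange (k b) (g c) (h d))) ⟩
    ∑[ c ∈ B ] ∑[ d ∈ B ] ∑[ b ∈ B ] ⟦ c +ᵛ (d +ᵛ b) ≟ᵛ y ⟧ * (g c * (h d * k b))
      ≡⟨ ∑-cong B (λ c → ∑-⊛ (λ a → c +ᵛ a ≟ᵛ y) (λ e → +ᵛ-boundedʳ e y≤L) (λ _ → g c) h k) ⟨
    ∑[ c ∈ B ] ∑[ a ∈ B ] ⟦ c +ᵛ a ≟ᵛ y ⟧ * (g c * (h ⊛ k) a) ∎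
    where
    open ≡-Reasoning
    B : List (Vec ℕ n)
    B = box L
    rearrange : ∀ z x u → z * (x * u) ≡ x * (u * z)
    rearrange = solve-∀

  δ-⊛ : ∀ a b → δ a ⊛ δ b ≐ δ (a +ᵛ b)
  δ-⊛ a b y y≤L = begin
    ∑[ m ∈ box L ] ∑[ k ∈ box L ] ⟦ m +ᵛ k ≟ᵛ y ⟧ * (⟦ a ≟ᵛ m ⟧ * ⟦ b ≟ᵛ k ⟧)
      ≡⟨ ∑-cong (box L) (λ m → trans (∑-cong (box L) λ k → shuffle ⟦ m +ᵛ k ≟ᵛ y ⟧ ⟦ a ≟ᵛ m ⟧ ⟦ b ≟ᵛ k ⟧)
                                     (sym (*-distribˡ-∑ ⟦ a ≟ᵛ m ⟧ (box L) _))) ⟩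
    ∑[ m ∈ box L ] ⟦ a ≟ᵛ m ⟧ * (∑[ k ∈ box L ] ⟦ b ≟ᵛ k ⟧ * ⟦ m +ᵛ k ≟ᵛ y ⟧)
      ≡⟨ ∑-cong (box L) (λ m → cong (⟦ a ≟ᵛ m ⟧ *_)
           (∑-box-pick-⟦⟧ L b (λ k → m +ᵛ k ≟ᵛ y) λ e → +ᵛ-boundedʳ e y≤L)) ⟩
    ∑[ m ∈ box L ] ⟦ a ≟ᵛ m ⟧ * ⟦ m +ᵛ b ≟ᵛ y ⟧
      ≡⟨ ∑-box-pick-⟦⟧ L a (λ m → m +ᵛ b ≟ᵛ y) (λ e → +ᵛ-boundedˡ e y≤L) ⟩
    ⟦ a +ᵛ b ≟ᵛ y ⟧ ∎
    where
    open ≡-Reasoning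
    shuffle : ∀ e u v → e * (u * v) ≡ u * (v * e)
    shuffle = solve-∀

  Σδ : List (Vec ℕ n) → Series
  Σδ ds y = ∑[ d ∈ ds ] δ d y

  monomials : Series → List (Vec ℕ n)
  monomials g = concatMap (λ d → List.replicate (g d) d) (box L)

  Σδ-monomials : ∀ g → Σδ (monomials g) ≐ g
  Σδ-monomials g y y≤L = begin
    Σδ (monomials g) y
      ≡⟨ ∑-concatMap (λ d → List.replicate (g d) d) (box L) _ ⟩
    ∑[ d ∈ box L ] ∑[ d′ ∈ List.replicate (g d) d ] δ d′ y
      ≡⟨ ∑-cong (box L) (λ d → ∑-replicate (g d) d _) ⟩
    ∑[ d ∈ box L ] g d * ⟦ d ≟ᵛ y ⟧
      ≡⟨ ∑-cong (box L) (λ d → trans (*-comm (g d) _) (cong (_* g d) (⟦≟ᵛ⟧-sym d y))) ⟩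
    ∑[ d ∈ box L ] ⟦ y ≟ᵛ d ⟧ * g d
      ≡⟨ ∑-box-pick-≤ L g y≤L ⟩
    g y ∎
    where open ≡-Reasoning

  -- dilate c g is g(t₁^c, …, t_n^c).
  dilate : ℕ → Series → Series
  dilate c g y = ∑[ j ∈ box L ] ⟦ c ·ᵛ j ≟ᵛ y ⟧ * g j

  module _ (c : ℕ) .{{_ : NonZero c}} where

    dilate-𝟘 : ∀ y → dilate c 𝟘 y ≡ 0
    dilate-𝟘 y = trans (∑-cong (box L) λ j → *-zeroʳ ⟦ c ·ᵛ j ≟ᵛ y ⟧) (∑-0 (box L))

    dilate-⊕ : ∀ g h y → dilate c (g ⊕ h) y ≡ (dilate c g ⊕ dilate c h) y
    dilate-⊕ g h y = trans (∑-cong (box L) λ j → *-distribˡ-+ ⟦ c ·ᵛ j ≟ᵛ y ⟧ (g j) (h j)) (∑-+ (box L) _ _)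

    dilate-δ : ∀ d → dilate c (δ d) ≐ δ (c ·ᵛ d)
    dilate-δ d y y≤L = trans (∑-cong (box L) λ j → *-comm ⟦ c ·ᵛ j ≟ᵛ y ⟧ ⟦ d ≟ᵛ j ⟧)
                             (∑-box-pick-⟦⟧ L d (λ j → c ·ᵛ j ≟ᵛ y) λ e → ·ᵛ-bounded c e y≤L)

    dilate-⊛ : ∀ g h → dilate c (g ⊛ h) ≐ dilate c g ⊛ dilate c h
    dilate-⊛ g h y y≤L = begin
      ∑[ j ∈ B ] ⟦ c ·ᵛ j ≟ᵛ y ⟧ * (g ⊛ h) j
        ≡⟨ ∑-cong B (λ j → cong (⟦ c ·ᵛ j ≟ᵛ y ⟧ *_) (*-identityˡ ((g ⊛ h) j))) ⟨
      ∑[ j ∈ B ] ⟦ c ·ᵛ j ≟ᵛ y ⟧ * (1 * (g ⊛ h) j)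
        ≡⟨ ∑-⊛ (λ j → c ·ᵛ j ≟ᵛ y) (λ e → ·ᵛ-bounded c e y≤L) (λ _ → 1) g h ⟩
      ∑[ a ∈ B ] ∑[ b ∈ B ] ⟦ c ·ᵛ (a +ᵛ b) ≟ᵛ y ⟧ * (1 * (g a * h b))
        ≡⟨ ∑-comm B B _ ⟩
      ∑[ b ∈ B ] ∑[ a ∈ B ] ⟦ c ·ᵛ (a +ᵛ b) ≟ᵛ y ⟧ * (1 * (g a * h b))
        ≡⟨ ∑-cong B (λ b → ∑-cong B λ a → cong₂ _*_
             (⟦⟧-cong (_ ≟ᵛ y) (_ ≟ᵛ y) (trans (sym (·ᵛ-distrib-+ᵛ c a b))) (trans (·ᵛ-distrib-+ᵛ c a b)))
             (trans (*-identityˡ _) (*-comm (g a) (h b)))) ⟩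
      ∑[ b ∈ B ] ∑[ a ∈ B ] ⟦ c ·ᵛ a +ᵛ c ·ᵛ b ≟ᵛ y ⟧ * (h b * g a)
        ≡⟨ ∑-cong B (λ b → ∑-box-pushforward L B (c ·ᵛ_) g (λ m → m +ᵛ c ·ᵛ b ≟ᵛ y)
                                               (λ e → +ᵛ-boundedˡ e y≤L) (λ _ → h b)) ⟨
      ∑[ b ∈ B ] ∑[ m ∈ B ] ⟦ m +ᵛ c ·ᵛ b ≟ᵛ y ⟧ * (h b * dilate c g m)
        ≡⟨ trans (∑-comm B B _) (∑-cong B λ m → ∑-cong B λ b →
             cong (⟦ m +ᵛ c ·ᵛ b ≟ᵛ y ⟧ *_) (*-comm (h b) _)) ⟩
      ∑[ m ∈ B ] ∑[ b ∈ B ] ⟦ m +ᵛ c ·ᵛ b ≟ᵛ y ⟧ * (dilate c g m * h b)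
        ≡⟨ ∑-cong B (λ m → ∑-box-pushforward L B (c ·ᵛ_) h (λ k → m +ᵛ k ≟ᵛ y)
                                               (λ e → +ᵛ-boundedʳ e y≤L) (λ _ → dilate c g m)) ⟨
      ∑[ m ∈ B ] ∑[ k ∈ B ] ⟦ m +ᵛ k ≟ᵛ y ⟧ * (dilate c g m * dilate c h k) ∎
      where
      open ≡-Reasoning
      B : List (Vec ℕ n)
      B = box L

module _ (p : ℕ) .{{_ : NonZero p}} where

  digit-join : ∀ {l a j x} → j ≤ x → l + p * (x ∸ j) ≡ a → a + p * j ≡ l + p * x
  digit-join {l} {j = j} {x} j≤x refl = begin
    l + p * (x ∸ j) + p * j ≡⟨ +-assoc l _ _ ⟩
    l + (p * (x ∸ j) + p * j) ≡⟨ cong (l +_) (*-distribˡ-+ p (x ∸ j) j) ⟨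
    l + p * (x ∸ j + j)     ≡⟨ cong (λ z → l + p * z) (m∸n+n≡m j≤x) ⟩
    l + p * x               ∎
    where open ≡-Reasoning

  digit-split : ∀ {l a j x} → l < p → a + p * j ≡ l + p * x → j ≤ x × l + p * (x ∸ j) ≡ a
  digit-split {l} {a} {j} {x} l<p a+pj≡l+px =
    j≤x , +-cancelʳ-≡ (p * j) _ _ (trans (digit-join j≤x refl) (sym a+pj≡l+px))
    where
    j≤x : j ≤ x
    j≤x = ≮⇒≥ λ x<j → <-irrefl (sym a+pj≡l+px) (begin-strict
      l + p * x   <⟨ +-monoˡ-< (p * x) l<p ⟩
      p + p * x   ≡⟨ *-suc p x ⟨
      p * suc x   ≤⟨ *-monoʳ-≤ p x<j ⟩
      p * j       ≤⟨ m≤n+m (p * j) a ⟩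
      a + p * j   ∎)
      where open ≤-Reasoning

  ·ᵛ-digit-join : ∀ {n} {ℓ₀ a j x : Vec ℕ n} → j ≤ᵛ x → ℓ₀ +ᵛ p ·ᵛ (x ∸ᵛ j) ≡ a →
                  a +ᵛ p ·ᵛ j ≡ ℓ₀ +ᵛ p ·ᵛ x
  ·ᵛ-digit-join {ℓ₀ = _ ∷ _} {_ ∷ _} (j≤x ∷ js≤xs) e =
    cong₂ _∷_ (digit-join j≤x (cong Vec.head e)) (·ᵛ-digit-join js≤xs (cong Vec.tail e))
  ·ᵛ-digit-join {ℓ₀ = []} {[]} [] refl = refl

  ·ᵛ-digit-split : ∀ {n} {ℓ₀ a j x : Vec ℕ n} → All (_< p) ℓ₀ → a +ᵛ p ·ᵛ j ≡ ℓ₀ +ᵛ p ·ᵛ x →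
                   j ≤ᵛ x × ℓ₀ +ᵛ p ·ᵛ (x ∸ᵛ j) ≡ a
  ·ᵛ-digit-split {ℓ₀ = _ ∷ _} {_ ∷ _} {_ ∷ _} {_ ∷ _} (l<p ∷ ls<p) e
    with j≤x , l≡a ← digit-split l<p (cong Vec.head e) | js≤xs , ls≡as ← ·ᵛ-digit-split ls<p (cong Vec.tail e)
    = j≤x ∷ js≤xs , cong₂ _∷_ l≡a ls≡as
  ·ᵛ-digit-split {ℓ₀ = []} {[]} {[]} {[]} [] refl = [] , refl

  x≤ᵛℓ₀+ᵛp·ᵛx : ∀ {n} (ℓ₀ x : Vec ℕ n) → x ≤ᵛ ℓ₀ +ᵛ p ·ᵛ x
  x≤ᵛℓ₀+ᵛp·ᵛx ℓ₀ x = ≤ᵛ-trans (u≤ᵛc·ᵛu p x) (+ᵛ-boundedʳ {u = ℓ₀} refl ≤ᵛ-refl)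

  +ᵛ-·ᵛ-monoʳ : ∀ {n} (ℓ₀ : Vec ℕ n) {m x} → m ≤ᵛ x → ℓ₀ +ᵛ p ·ᵛ m ≤ᵛ ℓ₀ +ᵛ p ·ᵛ x
  +ᵛ-·ᵛ-monoʳ [] [] = []
  +ᵛ-·ᵛ-monoʳ (l ∷ ℓ₀) (m≤x ∷ ms≤xs) = +-monoʳ-≤ l (*-monoʳ-≤ p m≤x) ∷ +ᵛ-·ᵛ-monoʳ ℓ₀ ms≤xs

module _ {n} (p : ℕ) .{{_ : NonZero p}} {ℓ₀ : Vec ℕ n} (ℓ₀<p : All (_< p) ℓ₀) (x : Vec ℕ n) where

  open Convolution (ℓ₀ +ᵛ p ·ᵛ x)

  ⊛-dilate-digits : ∀ h g →
                    (h ⊛ dilate p g) (ℓ₀ +ᵛ p ·ᵛ x) ≡ ∑[ m ∈ box x ] g (x ∸ᵛ m) * h (ℓ₀ +ᵛ p ·ᵛ m)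
  ⊛-dilate-digits h g = begin
    ∑[ a ∈ B ] ∑[ b ∈ B ] ⟦ a +ᵛ b ≟ᵛ L ⟧ * (h a * dilate p g b)
      ≡⟨ ∑-cong B (λ a → ∑-box-pushforward L B (p ·ᵛ_) g (λ b → a +ᵛ b ≟ᵛ L)
                                             (λ e → +ᵛ-boundedʳ e ≤ᵛ-refl) (λ _ → h a)) ⟩
    ∑[ a ∈ B ] ∑[ j ∈ B ] ⟦ a +ᵛ p ·ᵛ j ≟ᵛ L ⟧ * (h a * g j)
      ≡⟨ ∑-comm B B _ ⟩
    ∑[ j ∈ B ] ∑[ a ∈ B ] ⟦ a +ᵛ p ·ᵛ j ≟ᵛ L ⟧ * (h a * g j)
      ≡⟨ ∑-cong B (λ j → trans (∑-cong B λ a → split j a) (sym (*-distribˡ-∑ ⟦ j ≤ᵛ? x ⟧ B _))) ⟩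
    ∑[ j ∈ B ] ⟦ j ≤ᵛ? x ⟧ * (∑[ a ∈ B ] ⟦ u j ≟ᵛ a ⟧ * (h a * g j))
      ≡⟨ ∑-cong B (λ j → ⟦⟧-guard (j ≤ᵛ? x) λ j≤x → ∑-box-pick-≤ L (λ a → h a * g j) (u≤L j≤x)) ⟩
    ∑[ j ∈ B ] ⟦ j ≤ᵛ? x ⟧ * (h (u j) * g j)
      ≡⟨ ∑-box-restrict L (x≤ᵛℓ₀+ᵛp·ᵛx p ℓ₀ x) _ ⟩
    ∑[ j ∈ box x ] h (u j) * g j
      ≡⟨ ∑-box-reflect x _ ⟨
    ∑[ m ∈ box x ] h (u (x ∸ᵛ m)) * g (x ∸ᵛ m)
      ≡⟨ ∑-cong-All (box-bounded x) (λ m m≤x →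
           trans (cong (λ z → h (ℓ₀ +ᵛ p ·ᵛ z) * g (x ∸ᵛ m)) (∸ᵛ-flip m≤x refl))
                 (*-comm (h (ℓ₀ +ᵛ p ·ᵛ m)) (g (x ∸ᵛ m)))) ⟩
    ∑[ m ∈ box x ] g (x ∸ᵛ m) * h (ℓ₀ +ᵛ p ·ᵛ m) ∎
    where
    open ≡-Reasoning
    L : Vec ℕ n
    L = ℓ₀ +ᵛ p ·ᵛ x
    B : List (Vec ℕ n)
    B = box L
    u : Vec ℕ n → Vec ℕ n
    u j = ℓ₀ +ᵛ p ·ᵛ (x ∸ᵛ j)
    u≤L : ∀ {j} → j ≤ᵛ x → u j ≤ᵛ L
    u≤L j≤x = +ᵛ-boundedˡ (·ᵛ-digit-join p j≤x refl) ≤ᵛ-refl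
    split : ∀ j a → ⟦ a +ᵛ p ·ᵛ j ≟ᵛ L ⟧ * (h a * g j) ≡ ⟦ j ≤ᵛ? x ⟧ * (⟦ u j ≟ᵛ a ⟧ * (h a * g j))
    split j a = trans (cong (_* (h a * g j)) (trans
                        (⟦⟧-cong (_ ≟ᵛ L) ((j ≤ᵛ? x) ×-dec (u j ≟ᵛ a))
                                 (·ᵛ-digit-split p ℓ₀<p) λ (j≤x , e) → ·ᵛ-digit-join p j≤x e)
                        (⟦⟧-× (j ≤ᵛ? x) (u j ≟ᵛ a))))
                      (*-assoc ⟦ j ≤ᵛ? x ⟧ _ _)

-- Series compared on box L and modulo q: the ring (ℤ/q)[t₁, …, t_n] / (t^a : a ≰ L), g y being the
-- coefficient of t^y.
module Truncated {n : ℕ} (L : Vec ℕ n) (q : ℕ) .{{_ : NonZero q}} where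

  open Modulo q
  open Convolution L public

  infix 4 _≈_

  _≈_ : Series → Series → Set
  g ≈ h = ∀ y → y ≤ᵛ L → g y ≡ₘ h y

  ≐⇒≈ : ∀ {g h} → g ≐ h → g ≈ h
  ≐⇒≈ g≐h y y≤L = ≡ₘ-reflexive (g≐h y y≤L)

  ⊕-cong : ∀ {g g′ h h′} → g ≈ g′ → h ≈ h′ → g ⊕ h ≈ g′ ⊕ h′
  ⊕-cong g≈g′ h≈h′ y y≤L = +-cong-≡ₘ (g≈g′ y y≤L) (h≈h′ y y≤L)

  ⊛-cong : ∀ {g g′ h h′} → g ≈ g′ → h ≈ h′ → g ⊛ h ≈ g′ ⊛ h′
  ⊛-cong g≈g′ h≈h′ y y≤L = ∑-cong-≡ₘ (box L) λ a → ∑-cong-≡ₘ (box L) λ b →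
    ⟦⟧-guard-≡ₘ (a +ᵛ b ≟ᵛ y) λ a+b≡y →
      *-cong-≡ₘ (g≈g′ a (+ᵛ-boundedˡ a+b≡y y≤L)) (h≈h′ b (+ᵛ-boundedʳ a+b≡y y≤L))

  ≈-refl : ∀ {g} → g ≈ g
  ≈-refl _ _ = ≡ₘ-refl

  ≈-trans : ∀ {g h k} → g ≈ h → h ≈ k → g ≈ k
  ≈-trans g≈h h≈k y y≤L = ≡ₘ-trans (g≈h y y≤L) (h≈k y y≤L)

  ≈-isEquivalence : IsEquivalence _≈_
  ≈-isEquivalence = record
    { refl = ≈-refl
    ; sym = λ g≈h y y≤L → ≡ₘ-sym (g≈h y y≤L)
    ; trans = ≈-trans
    }

  isCommutativeSemiring : IsCommutativeSemiring _≈_ _⊕_ _⊛_ 𝟘 𝟙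
  isCommutativeSemiring = IsCommutativeSemiringˡ.isCommutativeSemiring record
    { +-isCommutativeMonoid = commutativeMonoid ⊕-cong
        (λ g h k → ≐⇒≈ λ y _ → +-assoc (g y) (h y) (k y))
        (λ g → ≐⇒≈ λ _ _ → refl)
        (λ g h → ≐⇒≈ λ y _ → +-comm (g y) (h y))
    ; *-isCommutativeMonoid = commutativeMonoid ⊛-cong
        (λ g h k → ≐⇒≈ (⊛-assoc g h k))
        (λ g → ≐⇒≈ (⊛-identityˡ g))
        (λ g h → ≐⇒≈ λ y _ → ⊛-comm g h y)
    ; distribʳ = λ k g h → ≐⇒≈ λ y _ → ⊛-distribʳ k g h y
    ; zeroˡ = λ g → ≐⇒≈ λ y _ → ⊛-zeroˡ g y
    }
    where
    commutativeMonoid : ∀ {_∙_ : Series → Series → Series} {ε} →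
      (∀ {g g′ h h′} → g ≈ g′ → h ≈ h′ → (g ∙ h) ≈ (g′ ∙ h′)) →
      (∀ g h k → ((g ∙ h) ∙ k) ≈ (g ∙ (h ∙ k))) → (∀ g → (ε ∙ g) ≈ g) → (∀ g h → (g ∙ h) ≈ (h ∙ g)) →
      IsCommutativeMonoid _≈_ _∙_ ε
    commutativeMonoid ∙-cong assoc identityˡ comm = isCommutativeMonoidˡ record
      { isSemigroup = record { isMagma = record { isEquivalence = ≈-isEquivalence ; ∙-cong = ∙-cong } ; assoc = assoc }
      ; identityˡ = identityˡ
      ; comm = comm
      }

  commutativeSemiring : CommutativeSemiring _ _
  commutativeSemiring = record { isCommutativeSemiring = isCommutativeSemiring }

  open CommutativeSemiring commutativeSemiring using (semiring)
  open import Algebra.Properties.Semiring.Exp semiring public using (_^_; ^-congˡ; ^-congʳ; ^-homo-*; ^-assocʳ)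

  δ-cong : ∀ {a b} → a ≡ b → δ a ≈ δ b
  δ-cong refl _ _ = ≡ₘ-refl

  δ-^ : ∀ d k → δ d ^ k ≈ δ (k ·ᵛ d)
  δ-^ d zero = δ-cong (sym (·ᵛ-zeroˡ d))
  δ-^ d (suc k) = begin
    δ d ⊛ δ d ^ k       ≈⟨ ⊛-cong {δ d} ≈-refl (δ-^ d k) ⟩
    δ d ⊛ δ (k ·ᵛ d)    ≈⟨ ≐⇒≈ (δ-⊛ d (k ·ᵛ d)) ⟩
    δ (d +ᵛ k ·ᵛ d)     ≈⟨ δ-cong (sym (·ᵛ-suc k d)) ⟩
    δ (suc k ·ᵛ d)      ∎
    where open import Relation.Binary.Reasoning.Setoid (CommutativeSemiring.setoid commutativeSemiring)

  module _ (c : ℕ) .{{_ : NonZero c}} where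

    dilate-cong : ∀ {g h} → g ≈ h → dilate c g ≈ dilate c h
    dilate-cong g≈h y y≤L =
      ∑-cong-≡ₘ (box L) λ j → ⟦⟧-guard-≡ₘ (c ·ᵛ j ≟ᵛ y) λ e → g≈h j (·ᵛ-bounded c e y≤L)

    dilate-^ : ∀ g k → dilate c (g ^ k) ≈ dilate c g ^ k
    dilate-^ g zero = ≈-trans (≐⇒≈ (dilate-δ c 0ᵛ)) (δ-cong (·ᵛ-zeroʳ c))
    dilate-^ g (suc k) = ≈-trans (≐⇒≈ (dilate-⊛ c g (g ^ k))) (⊛-cong {dilate c g} ≈-refl (dilate-^ g k))

  binomWithin-^ : ∀ f k {y} → y ≤ᵛ L → binomWithin f L k y ≡ (f ^ k) y
  binomWithin-^ f zero y≤L = trans (+-identityʳ _) (*-identityʳ _)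
  binomWithin-^ f (suc k) {y} y≤L = sym (begin
    ∑[ m ∈ B ] ∑[ b ∈ B ] ⟦ m +ᵛ b ≟ᵛ y ⟧ * (f m * (f ^ k) b)
      ≡⟨ ∑-cong B (λ m → ∑-cong B λ b → ⟦⟧-guard (m +ᵛ b ≟ᵛ y) λ e →
           cong (f m *_) (sym (binomWithin-^ f k (+ᵛ-boundedʳ e y≤L)))) ⟩
    ∑[ m ∈ B ] ∑[ b ∈ B ] ⟦ m +ᵛ b ≟ᵛ y ⟧ * (f m * binomWithin f L k b)
      ≡⟨ ∑-cong B (λ m → ∑-box-pushforward L (tuples k L) vsum (product ∘ List.map f)
                            (λ b → m +ᵛ b ≟ᵛ y) (λ e → +ᵛ-boundedʳ e y≤L) (λ _ → f m)) ⟩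
    ∑[ m ∈ B ] ∑[ ms ∈ tuples k L ] ⟦ m +ᵛ vsum ms ≟ᵛ y ⟧ * (f m * product (List.map f ms))
      ≡⟨ ∑-tuples-suc k L _ ⟨
    binomWithin f L (suc k) y ∎)
    where
    open ≡-Reasoning
    B : List (Vec ℕ n)
    B = box L

  binom-^ : ∀ f k {y} → y ≤ᵛ L → binom f k y ≡ (f ^ k) y
  binom-^ f k {y} y≤L = begin
    binom f k y           ≡⟨ binom≡binomWithin f k y ⟩
    binomWithin f y k y   ≡⟨ binomWithin-restrict f y≤L k ⟨
    binomWithin f L k y   ≡⟨ binomWithin-^ f k y≤L ⟩
    (f ^ k) y             ∎
    where open ≡-Reasoning

module Frobenius {n : ℕ} (L : Vec ℕ n) {p : ℕ} (p-prime : Prime p) where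

  private instance
    p≢0 : NonZero p
    p≢0 = prime⇒nonZero p-prime

  open Modulo p
  open Truncated L p public
  open CommutativeSemiring commutativeSemiring using (semiring)
  open FreshmansDream commutativeSemiring using (freshman's-dream)
  open import Algebra.Properties.Semiring.Mult semiring using () renaming (_×_ to _·_)
  open import Relation.Binary.Reasoning.Setoid (CommutativeSemiring.setoid commutativeSemiring)

  ·-apply : ∀ k g y → (k · g) y ≡ k * g y
  ·-apply zero g y = refl
  ·-apply (suc k) g y = cong (g y +_) (·-apply k g y)

  characteristic : ∀ g → p · g ≈ 𝟘
  characteristic g y _ = ≡ₘ-trans (≡ₘ-reflexive (·-apply p g y)) (∣⇒≡ₘ0 (m∣m*n (g y)))

  frobenius-Σδ : ∀ ds → Σδ ds ^ p ≈ dilate p (Σδ ds)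
  frobenius-Σδ [] = begin
    𝟘 ^ p                 ≈⟨ ^-congʳ 𝟘 (sym (suc-pred p)) ⟩
    𝟘 ⊛ 𝟘 ^ pred p        ≈⟨ ≐⇒≈ (λ y _ → ⊛-zeroˡ (𝟘 ^ pred p) y) ⟩
    𝟘                     ≈⟨ ≐⇒≈ (λ y _ → dilate-𝟘 p y) ⟨
    dilate p 𝟘            ∎
  frobenius-Σδ (d ∷ ds) = begin
    (δ d ⊕ Σδ ds) ^ p                 ≈⟨ freshman's-dream p-prime characteristic (δ d) (Σδ ds) ⟩
    δ d ^ p ⊕ Σδ ds ^ p               ≈⟨ ⊕-cong (δ-^ d p) (frobenius-Σδ ds) ⟩
    δ (p ·ᵛ d) ⊕ dilate p (Σδ ds)     ≈⟨ ⊕-cong (≐⇒≈ (dilate-δ p d)) ≈-refl ⟨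
    dilate p (δ d) ⊕ dilate p (Σδ ds) ≈⟨ ≐⇒≈ (λ y _ → dilate-⊕ p (δ d) (Σδ ds) y) ⟨
    dilate p (δ d ⊕ Σδ ds)            ∎

  -- Writing g as g d copies of each δ d keeps the coefficients out of the Frobenius map, so Fermat's
  -- little theorem is not needed.
  frobenius : ∀ g → g ^ p ≈ dilate p g
  frobenius g = begin
    g ^ p                       ≈⟨ ^-congˡ p (≐⇒≈ (Σδ-monomials g)) ⟨
    Σδ (monomials g) ^ p        ≈⟨ frobenius-Σδ (monomials g) ⟩
    dilate p (Σδ (monomials g)) ≈⟨ dilate-cong p (≐⇒≈ (Σδ-monomials g)) ⟩
    dilate p g                  ∎

  ^-split : ∀ g k₀ k₁ → g ^ (k₀ + k₁ * p) ≈ g ^ k₀ ⊛ dilate p (g ^ k₁)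
  ^-split g k₀ k₁ = begin
    g ^ (k₀ + k₁ * p)           ≈⟨ ^-homo-* g k₀ (k₁ * p) ⟩
    g ^ k₀ ⊛ g ^ (k₁ * p)       ≈⟨ ⊛-cong {g ^ k₀} ≈-refl (^-congʳ g (*-comm k₁ p)) ⟩
    g ^ k₀ ⊛ g ^ (p * k₁)       ≈⟨ ⊛-cong {g ^ k₀} ≈-refl (^-assocʳ g p k₁) ⟨
    g ^ k₀ ⊛ (g ^ p) ^ k₁       ≈⟨ ⊛-cong {g ^ k₀} ≈-refl (^-congˡ k₁ (frobenius g)) ⟩
    g ^ k₀ ⊛ dilate p g ^ k₁    ≈⟨ ⊛-cong {g ^ k₀} ≈-refl (dilate-^ p g k₁) ⟨
    g ^ k₀ ⊛ dilate p (g ^ k₁)  ∎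

toNatVec-vsubℤ : ∀ {n} {x m : Vec ℕ n} → m ≤ᵛ x → toNatVec (vsubℤ x m) ≡ just (x ∸ᵛ m)
toNatVec-vsubℤ {x = a ∷ x} {b ∷ m} (b≤a ∷ m≤x)
  rewrite ℤ.m-n≡m⊖n a b | ℤ.⊖-≥ b≤a | toNatVec-vsubℤ m≤x = refl
toNatVec-vsubℤ [] = refl

binomℤ-vsubℤ : ∀ {n} (f : Vec ℕ n → ℕ) k {x m : Vec ℕ n} → m ≤ᵛ x →
               binomℤ f k (vsubℤ x m) ≡ binom f k (x ∸ᵛ m)
binomℤ-vsubℤ f k m≤x rewrite toNatVec-vsubℤ m≤x = refl

open import Data.Integer using (+_; _-_)
open import Data.Integer.Divisibility using (_∣_)
import Data.List

theorem14 : (N : ℕ) → N ≥ 1 → (f : Vec ℕ N → ℕ) → (p : ℕ) → Prime p →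
    (k : ℕ) → (ℓ : Vec ℕ N) →
    (k₀ k₁ : ℕ) → k₀ < p → k ≡ k₀ + k₁ * p →
    (ℓ₀ x : Vec ℕ N) → All (_< p) ℓ₀ → ℓ ≡ zipWith _+_ ℓ₀ (map (p *_) x) →
    (+ p) ∣ ((+ binom f k ℓ)
             - (+ sum (Data.List.map
                        (λ m → binomℤ f k₁ (vsubℤ x m)
                               * binom f k₀ (zipWith _+_ ℓ₀ (map (p *_) m)))
                        (box x))))
theorem14 N _ f p p-prime k ℓ k₀ k₁ _ refl ℓ₀ x ℓ₀<p refl = ≡ₘ⇒∣- (begin
  binom f (k₀ + k₁ * p) L                                       ≡⟨ binom-^ f (k₀ + k₁ * p) ≤ᵛ-refl ⟩
  (f ^ (k₀ + k₁ * p)) L                                         ≈⟨ ^-split f k₀ k₁ L ≤ᵛ-refl ⟩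
  (f ^ k₀ ⊛ dilate p (f ^ k₁)) L                                ≡⟨ ⊛-dilate-digits p ℓ₀<p x (f ^ k₀) (f ^ k₁) ⟩
  ∑[ m ∈ box x ] (f ^ k₁) (x ∸ᵛ m) * (f ^ k₀) (ℓ₀ +ᵛ p ·ᵛ m)    ≡⟨ coefficients ⟨
  ∑[ m ∈ box x ] binomℤ f k₁ (vsubℤ x m) * binom f k₀ (ℓ₀ +ᵛ p ·ᵛ m) ∎)
  where
  instance
    p≢0 : NonZero p
    p≢0 = prime⇒nonZero p-prime
  L : Vec ℕ N
  L = ℓ₀ +ᵛ p ·ᵛ x
  open Modulo p
  open Frobenius L p-prime
  open import Relation.Binary.Reasoning.Setoid ≡ₘ-setoid
  coefficients : ∑[ m ∈ box x ] binomℤ f k₁ (vsubℤ x m) * binom f k₀ (ℓ₀ +ᵛ p ·ᵛ m)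
               ≡ ∑[ m ∈ box x ] (f ^ k₁) (x ∸ᵛ m) * (f ^ k₀) (ℓ₀ +ᵛ p ·ᵛ m)
  coefficients = ∑-cong-All (box-bounded x) λ m m≤x → cong₂ _*_
    (trans (binomℤ-vsubℤ f k₁ m≤x)
           (binom-^ f k₁ (≤ᵛ-trans (x∸ᵛy≤ᵛx x m) (x≤ᵛℓ₀+ᵛp·ᵛx p ℓ₀ x))))
    (binom-^ f k₀ (+ᵛ-·ᵛ-monoʳ p ℓ₀ m≤x))
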